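{- Let $n=2^j\ge 4$. Then exactly half of the subsets $S\subseteq[n-1]$ satisfy $\beta_n(S)\equiv 1\bmod 4$, and the other half satisfy $\beta_n(S)\equiv 3\bmod 4$.
   Context: For $S\subseteq[n-1]=\{1,\dots,n-1\}$, $\beta_n(S)$ is the number of permutations $\pi\in\mathfrak{S}_n$ whose descent set $\{i:\pi_i>\pi_{i+1}\}$ equals $S$. -}

module Defs where

open import Data.Nat using (ℕ; zero; suc; pred; _<ᵇ_)
open import Data.Bool using (Bool; true; false)
open import Data.Fin using (Fin; toℕ)
open import Data.Fin.Properties using () renaming (_≟_ to _≟ᶠ_)
open import Data.Fin.Subset using (Subset)
open import Data.Vec using (Vec; []; _∷_; toList)
open import Data.Vec.Properties using (≡-dec)
open import Data.Bool.Properties using () renaming (_≟_ to _≟ᵇ_)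
open import Data.List using (List; []; _∷_; length; filter; map; concatMap; allFin)
open import Relation.Unary using (Pred)
import Data.List.Relation.Unary.Unique.DecPropositional as UniqueDec

allVecs : ∀ {A : Set} → List A → (k : ℕ) → List (Vec A k)
allVecs xs zero    = [] ∷ []
allVecs xs (suc k) = concatMap (λ x → map (x ∷_) (allVecs xs k)) xs

-- Permutations of [n] in one-line notation: words π₁…πₙ over Fin n
-- (value i encodes i+1) with pairwise distinct letters.
-- This list enumerates each permutation in 𝔖ₙ exactly once.
permutations : (n : ℕ) → List (Vec (Fin n) n)
permutations n =
  filter (λ v → UniqueDec.unique? _≟ᶠ_ (toList v)) (allVecs (allFin n) n)

-- Descent indicator of a word of length k+1: entry i (0-based) is true
-- iff wᵢ > wᵢ₊₁, i.e. position i+1 ∈ [k] (1-based) is a descent.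
descentsV : ∀ {k} → Vec ℕ (suc k) → Vec Bool k
descentsV (x ∷ [])     = []
descentsV (x ∷ y ∷ ys) = (y <ᵇ x) ∷ descentsV (y ∷ ys)

toℕs : ∀ {n k} → Vec (Fin n) k → Vec ℕ k
toℕs []       = []
toℕs (x ∷ xs) = toℕ x ∷ toℕs xs

-- Descent set Des(π) ⊆ [n-1], as a subset of Fin (n-1)
-- (element i : Fin (n-1) stands for i+1 ∈ [n-1]).
descentSet : ∀ n → Vec (Fin n) n → Subset (pred n)
descentSet zero    []  = []
descentSet (suc n) π   = descentsV (toℕs π)

β : (n : ℕ) → Subset (pred n) → ℕ
β n S = length (filter (λ π → ≡-dec _≟ᵇ_ (descentSet n π) S) (permutations n))

allSubsets : (m : ℕ) → List (Subset m)
allSubsets m = allVecs (true ∷ false ∷ []) m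

-- Counting permutations by their first letter gives β_{k+1}(D) = Σ_r b_D(r), where
-- b_{d∷D}(r) sums b_D(y) over the ranks y < r of the second letter when position 1 is a
-- descent (d) and over y ≥ r otherwise: only the relative order of the unused letters matters.
-- Adding the two cases gives β_n({1} ∪ (T+1)) + β_n(T+1) = n · β_{n-1}(T), divisible by 4 when 4 ∣ n.
-- Modulo 2, b_{d∷D}(c) + b_{d∷D}(c+1) ≡ b_D(c); grouping the ranks in adjacent pairs twice gives
-- β_{2m}(D) ≡ β_m({i : 2i ∈ D}), hence every β_{2^j}(S) is odd.  Two odd numbers with sum ≡ 0
-- mod 4 are ≡ 1 and ≡ 3 in some order, so toggling 1 ∈ S matches the two residue classes.

module Submission where

open import Defs
open import Data.Nat using (ℕ; pred; _^_; _≤_; _%_; _∸_)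
open import Data.Nat.Properties using (_≟_)
open import Data.List using (length; filter)
open import Data.Product using (_×_)
open import Relation.Binary.PropositionalEquality using (_≡_)

open import Algebra.Bundles using (CommutativeMonoid; CommutativeRing)
import Algebra.Properties.CommutativeSemigroup as CommutativeSemigroupProperties
open import Data.Bool using (Bool; true; false; _∧_; not; _xor_; if_then_else_)
open import Data.Bool.Properties
  using (∧-commutativeMonoid; ∧-zeroʳ; ∧-identityʳ; xor-∧-commutativeRing; xor-same; xor-assoc;
         xor-identityʳ; not-distribˡ-xor; if-float; ¬-not; T-≡)
  renaming (_≟_ to _≟ᵇ_)
open import Data.Fin using (Fin; toℕ)
open import Data.Fin.Properties using () renaming (_≟_ to _≟ᶠ_)
open import Data.Fin.Subset using (Subset)
open import Data.List using (List; []; _∷_; _++_; map; concatMap; allFin; tabulate)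
open import Data.List.Properties using (map-cong; map-tabulate; length-++; length-map)
open import Data.List.Relation.Unary.All using (all?)
import Data.List.Relation.Unary.Unique.DecPropositional as UniqueDec
open import Data.Nat using (zero; suc; _+_; _*_; _<_; _<ᵇ_; _≡ᵇ_; z≤n; s≤s)
open import Data.Nat.DivMod using (_/_; m≡m%n+[m/n]*n; m%n<n; %-distribˡ-+)
open import Data.Nat.Divisibility using (_∣_; divides; ∣m⇒∣m*n; n∣m⇒m%n≡0)
open import Data.Nat.ListAction using (sum)
open import Data.Nat.Properties
  using (+-assoc; +-comm; +-identityʳ; +-commutativeSemigroup; *-comm; *-assoc; *-suc;
         ≤-refl; ≤-reflexive; ≤-trans; ≤-pred; m≤m+n; m≤n⇒m<n∨m≡n; m<n⇒m<1+n; n<1+n;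
         <⇒≢; <⇒≱; ≰⇒>; suc-injective; suc-pred; ^-monoʳ-≤; m^n≢0;
         <ᵇ-reflects-<; <⇒<ᵇ; <ᵇ⇒<; ≡ᵇ⇒≡; ≡⇒≡ᵇ)
open import Data.Product using (_,_)
open import Data.Sum using (_⊎_; inj₁; inj₂)
open import Data.Vec using (Vec; []; _∷_; toList)
open import Data.Vec.Properties using (≡-dec)
open import Function using (_∘_; id; Equivalence)
open import Level using (Level)
open import Relation.Binary.PropositionalEquality
  using (_≢_; refl; sym; trans; cong; cong₂; subst; module ≡-Reasoning)
open import Relation.Nullary using (does; ¬?)
open import Relation.Nullary.Reflects using (fromEquivalence; det)
open import Relation.Unary using (Pred; Decidable)

open import Algebra.Solver.CommutativeMonoid ∧-commutativeMonoid using (solve; _⊜_; _⊕_)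
open CommutativeSemigroupProperties +-commutativeSemigroup using () renaming (interchange to +-interchange)
open CommutativeSemigroupProperties (CommutativeMonoid.commutativeSemigroup ∧-commutativeMonoid)
  using () renaming (interchange to ∧-interchange)
open CommutativeSemigroupProperties (CommutativeRing.+-commutativeSemigroup xor-∧-commutativeRing)
  using () renaming (interchange to xor-interchange)
open ≡-Reasoning

private
  variable
    ℓ : Level
    A B : Set ℓ
    k : ℕ

ind : Bool → ℕ
ind b = if b then 1 else 0

∑< : ℕ → (ℕ → ℕ) → ℕ
∑< zero    f = 0
∑< (suc n) f = ∑< n f + f n

∑<-cong : ∀ n {f g : ℕ → ℕ} → (∀ x → x < n → f x ≡ g x) → ∑< n f ≡ ∑< n g
∑<-cong zero    eq = refl
∑<-cong (suc n) eq = cong₂ _+_ (∑<-cong n (λ x x<n → eq x (m<n⇒m<1+n x<n))) (eq n (n<1+n n))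

∑<-+ : ∀ n (f g : ℕ → ℕ) → ∑< n (λ x → f x + g x) ≡ ∑< n f + ∑< n g
∑<-+ zero    f g = refl
∑<-+ (suc n) f g = trans (cong (_+ (f n + g n)) (∑<-+ n f g)) (+-interchange (∑< n f) (∑< n g) (f n) (g n))

∑<-const : ∀ n c → ∑< n (λ _ → c) ≡ n * c
∑<-const zero    c = refl
∑<-const (suc n) c = trans (cong (_+ c) (∑<-const n c)) (+-comm (n * c) c)

∑<-suc : ∀ n (f : ℕ → ℕ) → ∑< (suc n) f ≡ f 0 + ∑< n (f ∘ suc)
∑<-suc zero    f = +-comm 0 (f 0)
∑<-suc (suc n) f = trans (cong (_+ f (suc n)) (∑<-suc n f)) (+-assoc (f 0) _ _)

∑<-mono-≤ : ∀ (f : ℕ → ℕ) {m n} → m ≤ n → ∑< m f ≤ ∑< n f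
∑<-mono-≤ f {n = zero}  z≤n = z≤n
∑<-mono-≤ f {n = suc n} m≤1+n with m≤n⇒m<n∨m≡n m≤1+n
... | inj₁ (s≤s m≤n) = ≤-trans (∑<-mono-≤ f m≤n) (m≤m+n (∑< n f) (f n))
... | inj₂ refl      = ≤-refl

sum-allFin : ∀ n {F : Fin n → ℕ} {f : ℕ → ℕ} → (∀ i → F i ≡ f (toℕ i)) → sum (map F (allFin n)) ≡ ∑< n f
sum-allFin n {F} eq = trans (cong sum (map-tabulate id F)) (sum-tabulate n eq)
  where
  sum-tabulate : ∀ n {F : Fin n → ℕ} {f : ℕ → ℕ} → (∀ i → F i ≡ f (toℕ i)) → sum (tabulate F) ≡ ∑< n f
  sum-tabulate zero    eq = refl
  sum-tabulate (suc n) {f = f} eq =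
    trans (cong₂ _+_ (eq Fin.zero) (sum-tabulate n (eq ∘ Fin.suc))) (sym (∑<-suc n f))

count : (A → Bool) → List A → ℕ
count p []       = 0
count p (x ∷ xs) = ind (p x) + count p xs

length-filter≡count : ∀ {P : Pred A ℓ} (P? : Decidable P) xs → length (filter P? xs) ≡ count (does ∘ P?) xs
length-filter≡count P? []       = refl
length-filter≡count P? (x ∷ xs) with does (P? x)
... | true  = cong suc (length-filter≡count P? xs)
... | false = length-filter≡count P? xs

count-filter : ∀ {P : Pred A ℓ} (P? : Decidable P) (q : A → Bool) xs →
               count q (filter P? xs) ≡ count (λ x → does (P? x) ∧ q x) xs
count-filter P? q []       = refl
count-filter P? q (x ∷ xs) with does (P? x)
... | true  = cong (ind (q x) +_) (count-filter P? q xs)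
... | false = count-filter P? q xs

count-cong : ∀ {p q : A → Bool} → (∀ x → p x ≡ q x) → ∀ xs → count p xs ≡ count q xs
count-cong eq []       = refl
count-cong eq (x ∷ xs) = cong₂ _+_ (cong ind (eq x)) (count-cong eq xs)

count-++ : ∀ (p : A → Bool) xs ys → count p (xs ++ ys) ≡ count p xs + count p ys
count-++ p []       ys = refl
count-++ p (x ∷ xs) ys = trans (cong (ind (p x) +_) (count-++ p xs ys)) (sym (+-assoc (ind (p x)) _ _))

count-map : ∀ (p : B → Bool) (f : A → B) xs → count p (map f xs) ≡ count (p ∘ f) xs
count-map p f []       = refl
count-map p f (x ∷ xs) = cong (ind (p (f x)) +_) (count-map p f xs)

count-concatMap : ∀ (p : B → Bool) (f : A → List B) xs → count p (concatMap f xs) ≡ sum (map (count p ∘ f) xs)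
count-concatMap p f []       = refl
count-concatMap p f (x ∷ xs) = trans (count-++ p (f x) _) (cong (count p (f x) +_) (count-concatMap p f xs))

count-∧ : ∀ b (p : A → Bool) xs → count (λ x → b ∧ p x) xs ≡ (if b then count p xs else 0)
count-∧ true  p xs       = refl
count-∧ false p []       = refl
count-∧ false p (x ∷ xs) = count-∧ false p xs

count-complementary : ∀ (p q : A → Bool) → (∀ x → ind (p x) + ind (q x) ≡ 1) → ∀ xs →
                      count p xs + count q xs ≡ length xs
count-complementary p q pq []       = refl
count-complementary p q pq (x ∷ xs) =
  trans (+-interchange (ind (p x)) (count p xs) (ind (q x)) (count q xs))
        (cong₂ _+_ (pq x) (count-complementary p q pq xs))

count-allVecs : ∀ (xs : List A) k (p : Vec A (suc k) → Bool) →
                count p (allVecs xs (suc k)) ≡ sum (map (λ x → count (p ∘ (x ∷_)) (allVecs xs k)) xs)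
count-allVecs xs k p =
  trans (count-concatMap p _ xs) (cong sum (map-cong (λ x → count-map p (x ∷_) (allVecs xs k)) xs))

length-allVecs : ∀ (xs : List A) k → length (allVecs xs k) ≡ length xs ^ k
length-allVecs xs zero    = refl
length-allVecs xs (suc k) = length-concatMap xs
  where
  length-concatMap : ∀ ys → length (concatMap (λ x → map (x ∷_) (allVecs xs k)) ys) ≡ length ys * length xs ^ k
  length-concatMap []       = refl
  length-concatMap (y ∷ ys) =
    trans (length-++ (map (y ∷_) (allVecs xs k)))
          (cong₂ _+_ (trans (length-map (y ∷_) (allVecs xs k)) (length-allVecs xs k)) (length-concatMap ys))

-- βstart k D r counts the permutations of {0,…,k} with descent vector D and first letter r:
-- after deleting the first letter, the new first letter has some rank y among the remaining
-- letters, and position 1 is a descent exactly when y < r.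
descentStep : ℕ → Bool → (ℕ → ℕ) → ℕ → ℕ
descentStep b d f r = ∑< b (λ y → if does ((y <ᵇ r) ≟ᵇ d) then f y else 0)

βstart : ∀ k → Vec Bool k → ℕ → ℕ
βstart zero    []      r = 1
βstart (suc k) (d ∷ D) r = descentStep (suc k) d (βstart k D) r

≢⇒≡ᵇ≡false : ∀ {x y} → x ≢ y → (x ≡ᵇ y) ≡ false
≢⇒≡ᵇ≡false {x} {y} x≢y = ¬-not (λ eq → x≢y (≡ᵇ⇒≡ x y (Equivalence.from T-≡ eq)))

≡ᵇ-refl : ∀ x → (x ≡ᵇ x) ≡ true
≡ᵇ-refl x = Equivalence.to T-≡ (≡⇒≡ᵇ x x refl)

rank : (ℕ → Bool) → ℕ → ℕ
rank al p = ∑< p (ind ∘ al)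

delete : ℕ → (ℕ → Bool) → ℕ → Bool
delete x al y = al y ∧ not (x ≡ᵇ y)

delete-≢ : ∀ al {x y} → x ≢ y → delete x al y ≡ al y
delete-≢ al {y = y} x≢y = trans (cong (λ b → al y ∧ not b) (≢⇒≡ᵇ≡false x≢y)) (∧-identityʳ (al y))

rank-mono-≤ : ∀ al {p q} → p ≤ q → rank al p ≤ rank al q
rank-mono-≤ al = ∑<-mono-≤ (ind ∘ al)

rank-suc : ∀ al {x} → al x ≡ true → suc (rank al x) ≡ rank al (suc x)
rank-suc al {x} ax = trans (+-comm 1 (rank al x)) (cong (λ b → rank al x + ind b) (sym ax))

rank-strict : ∀ al {x p} → al x ≡ true → x < p → rank al x < rank al p
rank-strict al ax x<p = ≤-trans (≤-reflexive (rank-suc al ax)) (rank-mono-≤ al x<p)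

rank-<ᵇ : ∀ al {x} p → al x ≡ true → (x <ᵇ p) ≡ (rank al x <ᵇ rank al p)
rank-<ᵇ al {x} p ax = det (<ᵇ-reflects-< x p) (fromEquivalence from (<⇒<ᵇ ∘ rank-strict al ax))
  where
  from : _ → x < p
  from r<r = ≰⇒> (λ p≤x → <⇒≱ (<ᵇ⇒< _ _ r<r) (rank-mono-≤ al p≤x))

∑<-rank : ∀ m al (f : ℕ → ℕ) → ∑< m (λ x → if al x then f (rank al x) else 0) ≡ ∑< (rank al m) f
∑<-rank zero    al f = refl
∑<-rank (suc m) al f with al m
... | true  = trans (cong (_+ f (rank al m)) (∑<-rank m al f)) (cong (λ r → ∑< r f) (+-comm 1 (rank al m)))
... | false = trans (+-identityʳ _) (trans (∑<-rank m al f) (cong (λ r → ∑< r f) (sym (+-identityʳ (rank al m)))))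

rank-delete-below : ∀ x al → rank (delete x al) x ≡ rank al x
rank-delete-below x al = ∑<-cong x (λ y y<x → cong ind (delete-≢ al (<⇒≢ y<x ∘ sym)))

rank-delete : ∀ {x} m al → x < m → al x ≡ true → suc (rank (delete x al) m) ≡ rank al m
rank-delete {x} (suc m) al x<1+m ax with m≤n⇒m<n∨m≡n x<1+m
... | inj₁ (s≤s x<m) = cong₂ _+_ (rank-delete m al x<m ax) (cong ind (delete-≢ al (<⇒≢ x<m)))
... | inj₂ refl      = begin
  suc (rank (delete x al) x + ind (al x ∧ not (x ≡ᵇ x)))
    ≡⟨ cong₂ (λ r b → suc (r + ind (al x ∧ not b))) (rank-delete-below x al) (≡ᵇ-refl x) ⟩
  suc (rank al x + ind (al x ∧ false))
    ≡⟨ cong (λ b → suc (rank al x + ind b)) (∧-zeroʳ (al x)) ⟩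
  suc (rank al x + 0)
    ≡⟨ cong suc (+-identityʳ (rank al x)) ⟩
  suc (rank al x)
    ≡⟨ rank-suc al ax ⟩
  rank al x + ind (al x) ∎

rank-all : ∀ n → rank (λ _ → true) n ≡ n
rank-all zero    = refl
rank-all (suc n) = trans (cong (_+ 1) (rank-all n)) (+-comm n 1)

does-≟ᶠ : ∀ {n} (x y : Fin n) → does (x ≟ᶠ y) ≡ (toℕ x ≡ᵇ toℕ y)
does-≟ᶠ Fin.zero    Fin.zero    = refl
does-≟ᶠ Fin.zero    (Fin.suc y) = refl
does-≟ᶠ (Fin.suc x) Fin.zero    = refl
does-≟ᶠ (Fin.suc x) (Fin.suc y) = does-≟ᶠ x y

matches : Vec ℕ (suc k) → Vec Bool k → Bool
matches u D = does (≡-dec _≟ᵇ_ (descentsV u) D)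

module Extensions (n : ℕ) where

  distinct : Vec (Fin n) k → Bool
  distinct w = does (UniqueDec.unique? _≟ᶠ_ (toList w))

  allowed : (ℕ → Bool) → Vec (Fin n) k → Bool
  allowed al []      = true
  allowed al (y ∷ w) = al (toℕ y) ∧ allowed al w

  admissible : (ℕ → Bool) → ℕ → Vec Bool k → Vec (Fin n) k → Bool
  admissible al p D w = distinct w ∧ (allowed al w ∧ matches (p ∷ toℕs w) D)

  extensions : (ℕ → Bool) → ℕ → Vec Bool k → ℕ
  extensions {k} al p D = count (admissible al p D) (allVecs (allFin n) k)

  allowed-∧ : ∀ al al' (w : Vec (Fin n) k) → allowed (λ y → al y ∧ al' y) w ≡ allowed al w ∧ allowed al' w
  allowed-∧ al al' []      = refl
  allowed-∧ al al' (y ∷ w) =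
    trans (cong ((al (toℕ y) ∧ al' (toℕ y)) ∧_) (allowed-∧ al al' w))
          (∧-interchange (al (toℕ y)) (al' (toℕ y)) (allowed al w) (allowed al' w))

  fresh≡allowed : ∀ x (w : Vec (Fin n) k) →
                  does (all? (λ y → ¬? (x ≟ᶠ y)) (toList w)) ≡ allowed (λ y → not (toℕ x ≡ᵇ y)) w
  fresh≡allowed x []      = refl
  fresh≡allowed x (y ∷ w) = cong₂ (λ b c → not b ∧ c) (does-≟ᶠ x y) (fresh≡allowed x w)

  admissible-∷ : ∀ al p d (D : Vec Bool k) x w →
                 admissible al p (d ∷ D) (x ∷ w)
                 ≡ al (toℕ x) ∧ (does ((toℕ x <ᵇ p) ≟ᵇ d) ∧ admissible (delete (toℕ x) al) (toℕ x) D w)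
  admissible-∷ al p d D x w = begin
    (fresh ∧ distinct w) ∧ ((al (toℕ x) ∧ allowed al w) ∧ (descent ∧ rest))
      ≡⟨ cong (λ b → (b ∧ distinct w) ∧ ((al (toℕ x) ∧ allowed al w) ∧ (descent ∧ rest))) (fresh≡allowed x w) ⟩
    (notX ∧ distinct w) ∧ ((al (toℕ x) ∧ allowed al w) ∧ (descent ∧ rest))
      ≡⟨ reorder notX (distinct w) (al (toℕ x)) (allowed al w) descent rest ⟩
    al (toℕ x) ∧ (descent ∧ (distinct w ∧ ((allowed al w ∧ notX) ∧ rest)))
      ≡⟨ cong (λ b → al (toℕ x) ∧ (descent ∧ (distinct w ∧ (b ∧ rest)))) (sym (allowed-∧ al _ w)) ⟩
    al (toℕ x) ∧ (descent ∧ admissible (delete (toℕ x) al) (toℕ x) D w) ∎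
    where
    fresh notX descent rest : Bool
    fresh   = does (all? (λ y → ¬? (x ≟ᶠ y)) (toList w))
    notX    = allowed (λ y → not (toℕ x ≡ᵇ y)) w
    descent = does ((toℕ x <ᵇ p) ≟ᵇ d)
    rest    = matches (toℕ x ∷ toℕs w) D
    reorder : ∀ f u a A c m → (f ∧ u) ∧ ((a ∧ A) ∧ (c ∧ m)) ≡ a ∧ (c ∧ (u ∧ ((A ∧ f) ∧ m)))
    reorder = solve 6 (λ f u a A c m → (f ⊕ u) ⊕ ((a ⊕ A) ⊕ (c ⊕ m)) ⊜ a ⊕ (c ⊕ (u ⊕ ((A ⊕ f) ⊕ m)))) refl

  extensions-∷ : ∀ al p d (D : Vec Bool k) →
                 extensions al p (d ∷ D)
                 ≡ ∑< n (λ x → if al x then (if does ((x <ᵇ p) ≟ᵇ d) then extensions (delete x al) x D else 0) else 0)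
  extensions-∷ {k} al p d D = begin
    count (admissible al p (d ∷ D)) (allVecs (allFin n) (suc k))
      ≡⟨ count-allVecs (allFin n) k _ ⟩
    sum (map (λ x → count (admissible al p (d ∷ D) ∘ (x ∷_)) words) (allFin n))
      ≡⟨ sum-allFin n (λ x → trans (count-cong (admissible-∷ al p d D x) words) (split x)) ⟩
    ∑< n (λ x → if al x then (if does ((x <ᵇ p) ≟ᵇ d) then extensions (delete x al) x D else 0) else 0) ∎
    where
    words : List (Vec (Fin n) k)
    words = allVecs (allFin n) k
    split : ∀ x → let a = al (toℕ x); c = does ((toℕ x <ᵇ p) ≟ᵇ d) in
            count (λ w → a ∧ (c ∧ admissible (delete (toℕ x) al) (toℕ x) D w)) words
            ≡ (if a then (if c then extensions (delete (toℕ x) al) (toℕ x) D else 0) else 0)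
    split x = trans (count-∧ (al (toℕ x)) _ words) (cong (if al (toℕ x) then_else 0) (count-∧ _ _ words))

  -- An unused letter lies below p iff its rank among the unused letters lies below that of p.
  extensions≡βstart : ∀ k (D : Vec Bool k) al p → rank al n ≡ k → extensions al p D ≡ βstart k D (rank al p)
  extensions≡βstart zero    []      al p _      = refl
  extensions≡βstart (suc k) (d ∷ D) al p rank≡ = begin
    extensions al p (d ∷ D)
      ≡⟨ extensions-∷ al p d D ⟩
    ∑< n (λ x → if al x then (if does ((x <ᵇ p) ≟ᵇ d) then extensions (delete x al) x D else 0) else 0)
      ≡⟨ ∑<-cong n step ⟩
    ∑< n (λ x → if al x then g (rank al x) else 0)
      ≡⟨ ∑<-rank n al g ⟩
    ∑< (rank al n) g
      ≡⟨ cong (λ m → ∑< m g) rank≡ ⟩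
    βstart (suc k) (d ∷ D) (rank al p) ∎
    where
    g : ℕ → ℕ
    g y = if does ((y <ᵇ rank al p) ≟ᵇ d) then βstart k D y else 0
    step : ∀ x → x < n → (if al x then (if does ((x <ᵇ p) ≟ᵇ d) then extensions (delete x al) x D else 0) else 0)
                         ≡ (if al x then g (rank al x) else 0)
    step x x<n with al x in ax
    ... | false = refl
    ... | true  = cong₂ (λ b m → if does (b ≟ᵇ d) then m else 0) (rank-<ᵇ al p ax) (begin
      extensions (delete x al) x D
        ≡⟨ extensions≡βstart k D (delete x al) x (suc-injective (trans (rank-delete n al x<n ax) rank≡)) ⟩
      βstart k D (rank (delete x al) x)
        ≡⟨ cong (βstart k D) (rank-delete-below x al) ⟩
      βstart k D (rank al x) ∎)

open Extensions using (extensions≡βstart; distinct; fresh≡allowed)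

β≡∑βstart : ∀ m (S : Vec Bool m) → β (suc m) S ≡ ∑< (suc m) (βstart m S)
β≡∑βstart m S = begin
  β n S
    ≡⟨ length-filter≡count _ (permutations n) ⟩
  count (λ π → matches (toℕs π) S) (permutations n)
    ≡⟨ count-filter _ _ (allVecs (allFin n) n) ⟩
  count (λ π → distinct n π ∧ matches (toℕs π) S) (allVecs (allFin n) n)
    ≡⟨ count-allVecs (allFin n) m _ ⟩
  sum (map (λ x → count (λ w → distinct n (x ∷ w) ∧ matches (toℕ x ∷ toℕs w) S) words) (allFin n))
    ≡⟨ sum-allFin n (λ x → count-cong (first-letter x) words) ⟩
  ∑< n (λ x → Extensions.extensions n (delete x all) x S)
    ≡⟨ ∑<-cong n (λ x x<n → trans (extensions≡βstart n m S (delete x all) x (rank-rest x<n))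
                                   (cong (βstart m S) (rank-below x))) ⟩
  ∑< n (βstart m S) ∎
  where
  n : ℕ
  n = suc m
  words : List (Vec (Fin n) m)
  words = allVecs (allFin n) m
  all : ℕ → Bool
  all _ = true
  first-letter : ∀ x w → distinct n (x ∷ w) ∧ matches (toℕ x ∷ toℕs w) S
                         ≡ Extensions.admissible n (delete (toℕ x) all) (toℕ x) S w
  first-letter x w =
    trans (cong (λ b → (b ∧ distinct n w) ∧ matches (toℕ x ∷ toℕs w) S) (fresh≡allowed n x w))
          (reorder (Extensions.allowed n (λ y → not (toℕ x ≡ᵇ y)) w) (distinct n w) (matches (toℕ x ∷ toℕs w) S))
    where
    reorder : ∀ f u c → (f ∧ u) ∧ c ≡ u ∧ (f ∧ c)
    reorder = solve 3 (λ f u c → (f ⊕ u) ⊕ c ⊜ u ⊕ (f ⊕ c)) refl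
  rank-rest : ∀ {x} → x < n → rank (delete x all) n ≡ m
  rank-rest x<n = suc-injective (trans (rank-delete n all x<n refl) (rank-all n))
  rank-below : ∀ x → rank (delete x all) x ≡ x
  rank-below x = trans (rank-delete-below x all) (rank-all x)

descentStep-true+false : ∀ b (f : ℕ → ℕ) r → descentStep b true f r + descentStep b false f r ≡ ∑< b f
descentStep-true+false b f r = trans (sym (∑<-+ b _ _)) (∑<-cong b (λ y _ → split (y <ᵇ r) (f y)))
  where
  split : ∀ c t → (if does (c ≟ᵇ true) then t else 0) + (if does (c ≟ᵇ false) then t else 0) ≡ t
  split true  t = +-identityʳ t
  split false t = refl

β-∷-sum : ∀ m (S : Vec Bool m) → β (suc (suc m)) (true ∷ S) + β (suc (suc m)) (false ∷ S) ≡ suc (suc m) * β (suc m) S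
β-∷-sum m S = begin
  β (suc (suc m)) (true ∷ S) + β (suc (suc m)) (false ∷ S)
    ≡⟨ cong₂ _+_ (β≡∑βstart (suc m) (true ∷ S)) (β≡∑βstart (suc m) (false ∷ S)) ⟩
  ∑< (suc (suc m)) (βstart (suc m) (true ∷ S)) + ∑< (suc (suc m)) (βstart (suc m) (false ∷ S))
    ≡⟨ sym (∑<-+ (suc (suc m)) _ _) ⟩
  ∑< (suc (suc m)) (λ r → βstart (suc m) (true ∷ S) r + βstart (suc m) (false ∷ S) r)
    ≡⟨ ∑<-cong (suc (suc m)) (λ r _ → descentStep-true+false (suc m) (βstart m S) r) ⟩
  ∑< (suc (suc m)) (λ _ → ∑< (suc m) (βstart m S))
    ≡⟨ ∑<-const (suc (suc m)) _ ⟩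
  suc (suc m) * ∑< (suc m) (βstart m S)
    ≡⟨ cong (suc (suc m) *_) (sym (β≡∑βstart m S)) ⟩
  suc (suc m) * β (suc m) S ∎

parity : ℕ → Bool
parity zero    = false
parity (suc n) = not (parity n)

parity-+ : ∀ m n → parity (m + n) ≡ parity m xor parity n
parity-+ zero    n = refl
parity-+ (suc m) n = trans (cong not (parity-+ m n)) (not-distribˡ-xor (parity m) (parity n))

⊕< : ℕ → (ℕ → Bool) → Bool
⊕< zero    u = false
⊕< (suc n) u = ⊕< n u xor u n

⊕<-cong : ∀ n {u v : ℕ → Bool} → (∀ x → x < n → u x ≡ v x) → ⊕< n u ≡ ⊕< n v
⊕<-cong zero    eq = refl
⊕<-cong (suc n) eq = cong₂ _xor_ (⊕<-cong n (λ x x<n → eq x (m<n⇒m<1+n x<n))) (eq n (n<1+n n))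

⊕<-xor : ∀ n (u v : ℕ → Bool) → ⊕< n (λ x → u x xor v x) ≡ ⊕< n u xor ⊕< n v
⊕<-xor zero    u v = refl
⊕<-xor (suc n) u v = trans (cong (_xor (u n xor v n)) (⊕<-xor n u v)) (xor-interchange (⊕< n u) (⊕< n v) (u n) (v n))

parity-∑< : ∀ n (f : ℕ → ℕ) → parity (∑< n f) ≡ ⊕< n (parity ∘ f)
parity-∑< zero    f = refl
parity-∑< (suc n) f = trans (parity-+ (∑< n f) (f n)) (cong (_xor parity (f n)) (parity-∑< n f))

⊕<-point : ∀ n {c} (u : ℕ → Bool) → c < n → ⊕< n (λ y → if y ≡ᵇ c then u y else false) ≡ u c
⊕<-point (suc n) {c} u c<1+n with m≤n⇒m<n∨m≡n c<1+n
... | inj₁ (s≤s c<n) =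
  trans (cong₂ _xor_ (⊕<-point n u c<n) (cong (if_then u n else false) (≢⇒≡ᵇ≡false (<⇒≢ c<n ∘ sym))))
        (xor-identityʳ (u c))
... | inj₂ refl      =
  cong₂ _xor_ (⊕<-vanishes c (λ y y<c → cong (if_then u y else false) (≢⇒≡ᵇ≡false (<⇒≢ y<c))))
              (cong (if_then u c else false) (≡ᵇ-refl c))
  where
  ⊕<-vanishes : ∀ n {v : ℕ → Bool} → (∀ y → y < n → v y ≡ false) → ⊕< n v ≡ false
  ⊕<-vanishes zero    _   = refl
  ⊕<-vanishes (suc n) eq = cong₂ _xor_ (⊕<-vanishes n (λ y y<n → eq y (m<n⇒m<1+n y<n))) (eq n (n<1+n n))

descentStepᵖ : ℕ → Bool → (ℕ → Bool) → ℕ → Bool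
descentStepᵖ b d u r = ⊕< b (λ y → if does ((y <ᵇ r) ≟ᵇ d) then u y else false)

parity-descentStep : ∀ b d (f : ℕ → ℕ) r → parity (descentStep b d f r) ≡ descentStepᵖ b d (parity ∘ f) r
parity-descentStep b d f r =
  trans (parity-∑< b _) (⊕<-cong b (λ y _ → if-float parity (does ((y <ᵇ r) ≟ᵇ d))))

descentStepᵖ-cong : ∀ b d {u v : ℕ → Bool} r → (∀ t → t < b → u t ≡ v t) → descentStepᵖ b d u r ≡ descentStepᵖ b d v r
descentStepᵖ-cong b d r eq = ⊕<-cong b (λ t t<b → cong (if does ((t <ᵇ r) ≟ᵇ d) then_else false) (eq t t<b))

-- Moving the threshold from c to c + 1 toggles exactly the term y = c.
descentStepᵖ-adjacent : ∀ b d (u : ℕ → Bool) {c} → c < b → descentStepᵖ b d u c xor descentStepᵖ b d u (suc c) ≡ u c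
descentStepᵖ-adjacent b d u {c} c<b =
  trans (sym (⊕<-xor b _ _)) (trans (⊕<-cong b (λ y _ → toggle d y c (u y))) (⊕<-point b u c<b))
  where
  toggle : ∀ d y c t → (if does ((y <ᵇ c) ≟ᵇ d) then t else false) xor (if does ((y <ᵇ suc c) ≟ᵇ d) then t else false)
                     ≡ (if y ≡ᵇ c then t else false)
  toggle true  zero    zero    t = refl
  toggle false zero    zero    t = xor-identityʳ t
  toggle d     zero    (suc c) t = xor-same (if does (true ≟ᵇ d) then t else false)
  toggle d     (suc y) zero    t = xor-same (if does (false ≟ᵇ d) then t else false)
  toggle d     (suc y) (suc c) t = toggle d y c t

double : ℕ → ℕ
double zero    = zero
double (suc n) = suc (suc (double n))

double-mono-≤ : ∀ {s t} → s ≤ t → double s ≤ double t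
double-mono-≤ z≤n       = z≤n
double-mono-≤ (s≤s s≤t) = s≤s (s≤s (double-mono-≤ s≤t))

double≡2* : ∀ n → double n ≡ 2 * n
double≡2* zero    = refl
double≡2* (suc n) = trans (cong (suc ∘ suc) (double≡2* n)) (sym (*-suc 2 n))

<ᵇ-double : ∀ t s → (double t <ᵇ double s) ≡ (t <ᵇ s)
<ᵇ-double zero    zero    = refl
<ᵇ-double zero    (suc s) = refl
<ᵇ-double (suc t) zero    = refl
<ᵇ-double (suc t) (suc s) = <ᵇ-double t s

<ᵇ-suc-double : ∀ t s → (suc (double t) <ᵇ double s) ≡ (t <ᵇ s)
<ᵇ-suc-double zero    zero    = refl
<ᵇ-suc-double zero    (suc s) = refl
<ᵇ-suc-double (suc t) zero    = refl
<ᵇ-suc-double (suc t) (suc s) = <ᵇ-suc-double t s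

pairSum : (ℕ → Bool) → ℕ → Bool
pairSum u s = u (double s) xor u (suc (double s))

⊕<-double : ∀ s (u : ℕ → Bool) → ⊕< (double s) u ≡ ⊕< s (pairSum u)
⊕<-double zero    u = refl
⊕<-double (suc s) u =
  trans (xor-assoc (⊕< (double s) u) (u (double s)) (u (suc (double s)))) (cong (_xor pairSum u s) (⊕<-double s u))

descentStepᵖ-double : ∀ K d (w : ℕ → Bool) s → descentStepᵖ (double K) d w (double s) ≡ descentStepᵖ K d (pairSum w) s
descentStepᵖ-double K d w s = trans (⊕<-double K _) (⊕<-cong K (λ t _ → pair t))
  where
  pair : ∀ t → (if does ((double t <ᵇ double s) ≟ᵇ d) then w (double t) else false)
               xor (if does ((suc (double t) <ᵇ double s) ≟ᵇ d) then w (suc (double t)) else false)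
               ≡ (if does ((t <ᵇ s) ≟ᵇ d) then pairSum w t else false)
  pair t rewrite <ᵇ-double t s | <ᵇ-suc-double t s with does ((t <ᵇ s) ≟ᵇ d)
  ... | true  = refl
  ... | false = refl

evens : ∀ k → Vec Bool (suc (double k)) → Vec Bool k
evens zero    (_ ∷ [])     = []
evens (suc k) (_ ∷ d ∷ D) = d ∷ evens k D

pairSum-βstart-∷ : ∀ k d (D : Vec Bool k) s → double s < suc k →
                   pairSum (parity ∘ βstart (suc k) (d ∷ D)) s ≡ parity (βstart k D (double s))
pairSum-βstart-∷ k d D s 2s<1+k =
  trans (cong₂ _xor_ (parity-descentStep (suc k) d (βstart k D) (double s))
                     (parity-descentStep (suc k) d (βstart k D) (suc (double s))))
        (descentStepᵖ-adjacent (suc k) d (parity ∘ βstart k D) 2s<1+k)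

pairSum-parity-βstart : ∀ k (D : Vec Bool (suc (double k))) s → s ≤ k →
                        pairSum (parity ∘ βstart (suc (double k)) D) s ≡ parity (βstart k (evens k D) s)
pairSum-parity-βstart zero    (d ∷ [])         s z≤n = pairSum-βstart-∷ zero d [] zero (s≤s z≤n)
pairSum-parity-βstart (suc k) (d₁ ∷ d₂ ∷ D) s s≤1+k = begin
  pairSum (parity ∘ βstart (suc (double (suc k))) (d₁ ∷ d₂ ∷ D)) s
    ≡⟨ pairSum-βstart-∷ (double (suc k)) d₁ (d₂ ∷ D) s (s≤s (double-mono-≤ s≤1+k)) ⟩
  parity (βstart (double (suc k)) (d₂ ∷ D) (double s))
    ≡⟨ parity-descentStep (double (suc k)) d₂ (βstart (suc (double k)) D) (double s) ⟩
  descentStepᵖ (double (suc k)) d₂ (parity ∘ βstart (suc (double k)) D) (double s)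
    ≡⟨ descentStepᵖ-double (suc k) d₂ _ s ⟩
  descentStepᵖ (suc k) d₂ (pairSum (parity ∘ βstart (suc (double k)) D)) s
    ≡⟨ descentStepᵖ-cong (suc k) d₂ s (λ t t<1+k → pairSum-parity-βstart k D t (≤-pred t<1+k)) ⟩
  descentStepᵖ (suc k) d₂ (parity ∘ βstart k (evens k D)) s
    ≡⟨ sym (parity-descentStep (suc k) d₂ (βstart k (evens k D)) s) ⟩
  parity (βstart (suc k) (d₂ ∷ evens k D) s) ∎

parity-β-evens : ∀ k (D : Vec Bool (suc (double k))) → parity (β (double (suc k)) D) ≡ parity (β (suc k) (evens k D))
parity-β-evens k D = begin
  parity (β (double (suc k)) D)
    ≡⟨ cong parity (β≡∑βstart (suc (double k)) D) ⟩
  parity (∑< (double (suc k)) (βstart (suc (double k)) D))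
    ≡⟨ parity-∑< (double (suc k)) _ ⟩
  ⊕< (double (suc k)) (parity ∘ βstart (suc (double k)) D)
    ≡⟨ ⊕<-double (suc k) _ ⟩
  ⊕< (suc k) (pairSum (parity ∘ βstart (suc (double k)) D))
    ≡⟨ ⊕<-cong (suc k) (λ s s<1+k → pairSum-parity-βstart k D s (≤-pred s<1+k)) ⟩
  ⊕< (suc k) (parity ∘ βstart k (evens k D))
    ≡⟨ sym (parity-∑< (suc k) _) ⟩
  parity (∑< (suc k) (βstart k (evens k D)))
    ≡⟨ cong parity (sym (β≡∑βstart k (evens k D))) ⟩
  parity (β (suc k) (evens k D)) ∎

2^≡suc-pred : ∀ j → 2 ^ j ≡ suc (pred (2 ^ j))
2^≡suc-pred j = sym (suc-pred (2 ^ j) {{m^n≢0 2 j}})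

β-odd : ∀ j {N} → N ≡ 2 ^ j → (S : Subset (pred N)) → parity (β N S) ≡ true
β-odd zero    refl [] = refl
β-odd (suc j) N≡ S with refl ← trans N≡ (trans (sym (double≡2* (2 ^ j))) (cong double (2^≡suc-pred j))) =
  trans (parity-β-evens (pred (2 ^ j)) S) (β-odd j (sym (2^≡suc-pred j)) (evens (pred (2 ^ j)) S))

parity-*4 : ∀ q → parity (q * 4) ≡ false
parity-*4 zero    = refl
parity-*4 (suc q) = cong (not ∘ not ∘ not ∘ not) (parity-*4 q)

parity-%4 : ∀ a → parity (a % 4) ≡ parity a
parity-%4 a = begin
  parity (a % 4)                      ≡⟨ sym (xor-identityʳ _) ⟩
  parity (a % 4) xor false            ≡⟨ cong (parity (a % 4) xor_) (sym (parity-*4 (a / 4))) ⟩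
  parity (a % 4) xor parity (a / 4 * 4) ≡⟨ sym (parity-+ (a % 4) (a / 4 * 4)) ⟩
  parity (a % 4 + a / 4 * 4)          ≡⟨ cong parity (sym (m≡m%n+[m/n]*n a 4)) ⟩
  parity a                            ∎

odd-residues : ∀ x y → x < 4 → y < 4 → parity x ≡ true → parity y ≡ true → (x + y) % 4 ≡ 0 →
               (x ≡ 1 × y ≡ 3) ⊎ (x ≡ 3 × y ≡ 1)
odd-residues 0 _ _ _ () _ _
odd-residues 2 _ _ _ () _ _
odd-residues (suc (suc (suc (suc _)))) _ (s≤s (s≤s (s≤s (s≤s ())))) _ _ _ _
odd-residues _ 0 _ _ _ () _
odd-residues _ 2 _ _ _ () _
odd-residues _ (suc (suc (suc (suc _)))) _ (s≤s (s≤s (s≤s (s≤s ())))) _ _ _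
odd-residues 1 1 _ _ _ _ ()
odd-residues 1 3 _ _ _ _ _ = inj₁ (refl , refl)
odd-residues 3 1 _ _ _ _ _ = inj₂ (refl , refl)
odd-residues 3 3 _ _ _ _ ()

odd-pair-%4 : ∀ a b → parity a ≡ true → parity b ≡ true → 4 ∣ a + b →
              (a % 4 ≡ 1 × b % 4 ≡ 3) ⊎ (a % 4 ≡ 3 × b % 4 ≡ 1)
odd-pair-%4 a b odd-a odd-b 4∣a+b =
  odd-residues (a % 4) (b % 4) (m%n<n a 4) (m%n<n b 4)
    (trans (parity-%4 a) odd-a) (trans (parity-%4 b) odd-b)
    (trans (sym (%-distribˡ-+ a b 4)) (n∣m⇒m%n≡0 (a + b) 4 4∣a+b))

exactly-one-≡ᵇ : ∀ {x y r} → (x ≡ 1 × y ≡ 3) ⊎ (x ≡ 3 × y ≡ 1) → r ≡ 1 ⊎ r ≡ 3 → ind (x ≡ᵇ r) + ind (y ≡ᵇ r) ≡ 1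
exactly-one-≡ᵇ (inj₁ (refl , refl)) (inj₁ refl) = refl
exactly-one-≡ᵇ (inj₁ (refl , refl)) (inj₂ refl) = refl
exactly-one-≡ᵇ (inj₂ (refl , refl)) (inj₁ refl) = refl
exactly-one-≡ᵇ (inj₂ (refl , refl)) (inj₂ refl) = refl

residue-class-halves : ∀ N → 2 ≤ N → 4 ∣ N → (∀ S → parity (β N S) ≡ true) → ∀ r → r ≡ 1 ⊎ r ≡ 3 →
                       length (filter (λ S → β N S % 4 ≟ r) (allSubsets (pred N))) ≡ 2 ^ (N ∸ 2)
residue-class-halves (suc (suc m)) (s≤s (s≤s z≤n)) 4∣N odd r r∈ = begin
  length (filter (λ S → β N S % 4 ≟ r) (allSubsets (suc m)))
    ≡⟨ length-filter≡count (λ S → β N S % 4 ≟ r) (allSubsets (suc m)) ⟩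
  count inClass (allSubsets (suc m))
    ≡⟨ count-allVecs (true ∷ false ∷ []) m inClass ⟩
  count (inClass ∘ (true ∷_)) (allSubsets m) + (count (inClass ∘ (false ∷_)) (allSubsets m) + 0)
    ≡⟨ cong (count (inClass ∘ (true ∷_)) (allSubsets m) +_) (+-identityʳ _) ⟩
  count (inClass ∘ (true ∷_)) (allSubsets m) + count (inClass ∘ (false ∷_)) (allSubsets m)
    ≡⟨ count-complementary _ _ one-in-class (allSubsets m) ⟩
  length (allSubsets m)
    ≡⟨ length-allVecs (true ∷ false ∷ []) m ⟩
  2 ^ m ∎
  where
  N : ℕ
  N = suc (suc m)
  inClass : Subset (suc m) → Bool
  inClass S = β N S % 4 ≡ᵇ r
  one-in-class : ∀ S → ind (inClass (true ∷ S)) + ind (inClass (false ∷ S)) ≡ 1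
  one-in-class S =
    exactly-one-≡ᵇ (odd-pair-%4 (β N (true ∷ S)) (β N (false ∷ S)) (odd (true ∷ S)) (odd (false ∷ S)) 4∣sum) r∈
    where
    4∣sum : 4 ∣ β N (true ∷ S) + β N (false ∷ S)
    4∣sum = subst (4 ∣_) (sym (β-∷-sum m S)) (∣m⇒∣m*n (β (suc m) S) 4∣N)

4∣2^2+i : ∀ i → 4 ∣ 2 ^ suc (suc i)
4∣2^2+i i = divides (2 ^ i) (trans (sym (*-assoc 2 2 (2 ^ i))) (*-comm 4 (2 ^ i)))

theorem3p5 : ∀ (j : ℕ) → 2 ≤ j →
    length (filter (λ S → β (2 ^ j) S % 4 ≟ 1) (allSubsets (pred (2 ^ j)))) ≡ 2 ^ (2 ^ j ∸ 2)
    × length (filter (λ S → β (2 ^ j) S % 4 ≟ 3) (allSubsets (pred (2 ^ j)))) ≡ 2 ^ (2 ^ j ∸ 2)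
theorem3p5 j@(suc (suc i)) (s≤s (s≤s z≤n)) = halves 1 (inj₁ refl) , halves 3 (inj₂ refl)
  where
  halves : ∀ r → r ≡ 1 ⊎ r ≡ 3 →
           length (filter (λ S → β (2 ^ j) S % 4 ≟ r) (allSubsets (pred (2 ^ j)))) ≡ 2 ^ (2 ^ j ∸ 2)
  halves = residue-class-halves (2 ^ j) (^-monoʳ-≤ 2 {1} {j} (s≤s z≤n)) (4∣2^2+i i) (β-odd j refl)
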